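{- Let $\mathcal{S}=\langle\mathcal{L},\vdash\rangle$ be a logic whose signature contains a unary operator $\neg$, and let $\varrho\subseteq\mathcal{P}(\mathcal{L})\times\mathcal{L}$ have finite reach. Then $\neg$-ECQ fails in both $\mathcal{S}^\varrho$ and $\mathcal{S}^{p\varrho}$: there exist $\alpha,\beta\in\mathcal{L}$ with $\{\alpha,\neg\alpha\}\not\vdash^\varrho\beta$, and there exist $\alpha',\beta'\in\mathcal{L}$ with $\{\alpha',\neg\alpha'\}\not\vdash^{p\varrho}\beta'$. Thus $\mathcal{S}^\varrho$ and $\mathcal{S}^{p\varrho}$ are paraconsistent with respect to $\neg$.
   Context: A logic is a pair $\langle\mathcal{L},\vdash\rangle$ where $\mathcal{L}$ is the formula algebra of some finite signature over a nonempty set of variables $V$ and $\vdash\,\subseteq\mathcal{P}(\mathcal{L})\times\mathcal{L}$ is an arbitrary relation. For $\varrho\subseteq\mathcal{P}(\mathcal{L})\times\mathcal{L}$, the $\varrho$-companion $\mathcal{S}^\varrho=\langle\mathcal{L},\vdash^\varrho\rangle$: $\Gamma\vdash^\varrho\alpha$ iff there is $\Delta\subseteq\Gamma$ with $(\Delta,\alpha)\in\varrho$ and $\Delta\vdash\alpha$. The pure $\varrho$-companion $\mathcal{S}^{p\varrho}=\langle\mathcal{L},\vdash^{p\varrho}\rangle$: $\Gamma\vdash^{p\varrho}\alpha$ iff there is a nonempty $\Delta\subseteq\Gamma$ with $(\Delta,\alpha)\in\varrho$ and $\Delta\vdash\alpha$. A relation $\varrho\subseteq A\times B$ has finite reach if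 for every $a\in A$ the set $\{b\in B\mid (a,b)\in\varrho\}$ is finite. $\neg$-ECQ in $\langle\mathcal{L},\vdash'\rangle$ is the principle that $\{\alpha,\neg\alpha\}\vdash'\beta$ for all $\alpha,\beta\in\mathcal{L}$. -}

module Defs where

open import Level using (0ℓ)
open import Data.Nat using (ℕ)
open import Data.Fin using (Fin)
open import Data.Vec using (Vec)
open import Data.List using (List)
open import Data.List.Membership.Propositional using (_∈_)
open import Data.Product using (Σ; ∃; _×_)
open import Data.Sum using (_⊎_)
open import Relation.Unary using (Pred; _⊆_; _≐_; Satisfiable)
open import Relation.Binary.PropositionalEquality using (_≡_; subst; sym)
open import Data.Vec using ([]; _∷_)

record Signature : Set where
  field
    nOps  : ℕ
    arity : Fin nOps → ℕ

module _ (Σg : Signature) where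
  open Signature Σg

  data Formula (V : Set) : Set where
    var : V → Formula V
    app : (f : Fin nOps) → Vec (Formula V) (arity f) → Formula V

Subset : Set → Set₁
Subset L = Pred L 0ℓ

Rel : Set → Set₁
Rel L = Subset L → L → Set

companion : {L : Set} → Rel L → Rel L → Subset L → L → Set₁
companion ⊢ ρ Γ α = Σ (Subset _) λ Δ → Δ ⊆ Γ × ρ Δ α × ⊢ Δ α

pureCompanion : {L : Set} → Rel L → Rel L → Subset L → L → Set₁
pureCompanion ⊢ ρ Γ α =
  Σ (Subset _) λ Δ → Satisfiable Δ × Δ ⊆ Γ × ρ Δ α × ⊢ Δ α

FiniteReach : {L : Set} → Rel L → Set₁
FiniteReach {L} ρ = ∀ (Δ : Subset L) → ∃ λ (xs : List L) → ∀ β → ρ Δ β → β ∈ xs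

-- ρ is a relation on *sets*: it cannot distinguish extensionally equal subsets.
Extensional : {L : Set} → Rel L → Set₁
Extensional {L} ρ = ∀ {Δ Δ' : Subset L} {β} → Δ ≐ Δ' → ρ Δ β → ρ Δ' β

pair : {L : Set} → (L → L) → L → Subset L
pair neg α x = x ≡ α ⊎ x ≡ neg α

negOf : (Σg : Signature) {V : Set} (s : Fin (Signature.nOps Σg)) →
        Signature.arity Σg s ≡ 1 → Formula Σg V → Formula Σg V
negOf Σg {V} s eq a = app s (subst (Vec (Formula Σg V)) (sym eq) (a ∷ []))

-- A companion can only derive β from a subset Δ of the premisses when (Δ, β) ∈ ρ.
-- The premiss set {α, ¬α} has just four subsets, so by finite reach only finitely
-- many conclusions are ever reachable from it; a formula of greater height than
-- all of them, such as ¬ applied to the tallest one, is not derivable.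
module Submission where

open import Defs
open import Data.Bool using (Bool; true; false; T)
open import Data.Fin using (Fin)
open import Data.List using (List; []; _∷_; _++_)
open import Data.List.Extrema.Nat using (argmax; f[xs]≤f[argmax])
open import Data.List.Membership.Propositional using (_∈_; _∉_)
open import Data.List.Membership.Propositional.Properties using (∈-++⁺ˡ; ∈-++⁺ʳ)
import Data.List.Relation.Unary.All as All
open import Data.List.Relation.Unary.Any using (here; there)
open import Data.Nat using (ℕ; suc; _⊔_; _<_; s≤s)
open import Data.Nat.Properties using (m≤m⊔n; ≤-trans; ≤-reflexive; <⇒≱)
open import Data.Product using (∃; _×_; _,_)
open import Data.Sum using (_⊎_; inj₁; inj₂)
open import Data.Vec using (Vec; []; _∷_)
open import Function using (_∘_)
open import Relation.Nullary using (¬_; Dec)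
open import Relation.Nullary.Decidable using (isYes; toWitness; fromWitness; ¬¬-excluded-middle)
open import Relation.Binary.PropositionalEquality using (_≡_; refl; subst; sym)
open import Relation.Unary using (_⊆_; _≐_)

module _ {L : Set} where

  pureCompanion⇒companion : ∀ {⊢ ρ : Rel L} {Γ β} →
    pureCompanion ⊢ ρ Γ β → companion ⊢ ρ Γ β
  pureCompanion⇒companion (Δ , _ , Δ⊆Γ , r , d) = Δ , Δ⊆Γ , r , d

  finiteReach-⋃ : ∀ {ρ : Rel L} → FiniteReach ρ → (Ds : List (Subset L)) →
    ∃ λ xs → ∀ {Δ β} → Δ ∈ Ds → ρ Δ β → β ∈ xs
  finiteReach-⋃ fr [] = [] , λ ()
  finiteReach-⋃ {ρ} fr (D ∷ Ds) with fr D | finiteReach-⋃ fr Ds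
  ... | ys , coverD | zs , coverDs = ys ++ zs , cover
    where
    cover : ∀ {Δ β} → Δ ∈ D ∷ Ds → ρ Δ β → β ∈ ys ++ zs
    cover (here refl) r = ∈-++⁺ˡ (coverD _ r)
    cover (there Δ∈Ds) r = ∈-++⁺ʳ ys (coverDs Δ∈Ds r)

  -- Only classically: membership in Δ need not be decidable, but the consequence
  -- we draw (underivability) is a negation, so ¬¬ is all we can and need to provide.
  FinitelyManySubsets : Subset L → Set₁
  FinitelyManySubsets Γ =
    ∃ λ (Ds : List (Subset L)) → ∀ {Δ} → Δ ⊆ Γ → ¬ ¬ (∃ λ D → D ∈ Ds × Δ ≐ D)

  companion-finiteReach : ∀ {⊢ ρ : Rel L} {Γ} → Extensional ρ → FiniteReach ρ →
    FinitelyManySubsets Γ → ∃ λ xs → ∀ β → β ∉ xs → ¬ companion ⊢ ρ Γ β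
  companion-finiteReach ext fr (Ds , classify) with finiteReach-⋃ fr Ds
  ... | xs , cover = xs , λ β β∉xs (Δ , Δ⊆Γ , r , _) →
    classify Δ⊆Γ λ (D , D∈Ds , Δ≐D) → β∉xs (cover D∈Ds (ext Δ≐D r))

  module _ (neg : L → L) (α : L) where

    pairPart : Bool → Bool → Subset L
    pairPart b₁ b₂ x = (x ≡ α × T b₁) ⊎ (x ≡ neg α × T b₂)

    pairParts : List (Subset L)
    pairParts = pairPart true true ∷ pairPart true false
              ∷ pairPart false true ∷ pairPart false false ∷ []

    pairPart∈pairParts : ∀ b₁ b₂ → pairPart b₁ b₂ ∈ pairParts
    pairPart∈pairParts true  true  = here refl
    pairPart∈pairParts true  false = there (here refl)
    pairPart∈pairParts false true  = there (there (here refl))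
    pairPart∈pairParts false false = there (there (there (here refl)))

    ⊆pair⇒≐pairPart : ∀ {Δ : Subset L} → Δ ⊆ pair neg α →
      (Δα? : Dec (Δ α)) (Δ¬α? : Dec (Δ (neg α))) → Δ ≐ pairPart (isYes Δα?) (isYes Δ¬α?)
    ⊆pair⇒≐pairPart {Δ} Δ⊆pair Δα? Δ¬α? = to , from
      where
      to : Δ ⊆ pairPart (isYes Δα?) (isYes Δ¬α?)
      to Δx with Δ⊆pair Δx
      ... | inj₁ refl = inj₁ (refl , fromWitness {a? = Δα?} Δx)
      ... | inj₂ refl = inj₂ (refl , fromWitness {a? = Δ¬α?} Δx)
      from : pairPart (isYes Δα?) (isYes Δ¬α?) ⊆ Δ
      from (inj₁ (refl , t)) = toWitness t
      from (inj₂ (refl , t)) = toWitness t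

    pair-finitelyManySubsets : FinitelyManySubsets (pair neg α)
    pair-finitelyManySubsets = pairParts , λ Δ⊆pair k →
      ¬¬-excluded-middle λ Δα? → ¬¬-excluded-middle λ Δ¬α? →
        k ( pairPart (isYes Δα?) (isYes Δ¬α?) , pairPart∈pairParts _ _
          , ⊆pair⇒≐pairPart Δ⊆pair Δα? Δ¬α?)

module _ (Σg : Signature) {V : Set} where
  open Signature Σg

  mutual
    height : Formula Σg V → ℕ
    height (var _)    = 0
    height (app _ as) = suc (heights as)

    heights : ∀ {n} → Vec (Formula Σg V) n → ℕ
    heights []       = 0
    heights (a ∷ as) = height a ⊔ heights as

  heights-cast : ∀ {n} (eq : n ≡ 1) (a : Formula Σg V) →
    heights (subst (Vec (Formula Σg V)) (sym eq) (a ∷ [])) ≡ height a ⊔ 0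
  heights-cast refl a = refl

  height-negOf : (s : Fin nOps) (eq : arity s ≡ 1) (a : Formula Σg V) →
    height a < height (negOf Σg s eq a)
  height-negOf s eq a =
    s≤s (≤-trans (m≤m⊔n (height a) 0) (≤-reflexive (sym (heights-cast eq a))))

  negOf-tallest-∉ : (s : Fin nOps) (eq : arity s ≡ 1) (a : Formula Σg V)
    (xs : List (Formula Σg V)) → negOf Σg s eq (argmax height a xs) ∉ xs
  negOf-tallest-∉ s eq a xs β∈xs =
    <⇒≱ (height-negOf s eq (argmax height a xs))
        (All.lookup (f[xs]≤f[argmax] {f = height} a xs) β∈xs)

mainTheorem10 : (Σg : Signature) (V : Set) → V →
    (negSym : Fin (Signature.nOps Σg)) → (neg1 : Signature.arity Σg negSym ≡ 1) →
    (⊢ ρ : Rel (Formula Σg V)) → Extensional ρ → FiniteReach ρ →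
    (∃ λ α → ∃ λ β → ¬ companion ⊢ ρ (pair (negOf Σg negSym neg1) α) β)
    × (∃ λ α' → ∃ λ β' → ¬ pureCompanion ⊢ ρ (pair (negOf Σg negSym neg1) α') β')
mainTheorem10 Σg V v negSym neg1 ⊢ ρ ext fr with
  companion-finiteReach {⊢ = ⊢} ext fr (pair-finitelyManySubsets (negOf Σg negSym neg1) (var v))
... | reachable , underivable =
  (α , β , α,¬α⊬β) , (α , β , α,¬α⊬β ∘ pureCompanion⇒companion {⊢ = ⊢} {ρ})
  where
  neg : Formula Σg V → Formula Σg V
  neg = negOf Σg negSym neg1
  α β : Formula Σg V
  α = var v
  β = neg (argmax (height Σg) α reachable)
  α,¬α⊬β : ¬ companion ⊢ ρ (pair neg α) β
  α,¬α⊬β = underivable β (negOf-tallest-∉ Σg negSym neg1 α reachable)
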